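{- The series $\mathbf{ns}(\mathbf{ld})$ satisfies $\mathbf{ns}(\mathbf{ld}) = \mathbf{md}_1(\mathbf{ns}(\mathbf{ld}))$ where, for every $k\ge1$, $$\mathbf{md}_k(\mathbf{ns}(\mathbf{ld})) = \epsilon^{\otimes k} + \sum_{u\in\{\circ,\bullet\}^k}\mathrm{mg}_u\Big(\mathbf{md}_{k+|u|_\bullet}(\mathbf{ns}(\mathbf{ld}))\Big) + \bar{\bullet}\Big(\mathbf{md}_k\big(\mathbf{ns}(\mathrm{P}^2_{\odot}(\Delta(\mathbf{ld})))\big)\Big).$$
   Context: A duplicative tree is a planar rooted tree each of whose nodes is white or black; a duplicative forest is a finite word of duplicative trees, $\epsilon$ the empty forest, $\mathcal{D}^*$ the set of forests. For a forest $\mathfrak{g}$, $\circ(\mathfrak{g})$ (resp. $\bullet(\mathfrak{g})$) is the tree with white (resp. black) root and subtree sequence $\mathfrak{g}$; concatenation is $\mathfrak{g}\odot\mathfrak{g}'=\mathfrak{g}\mathfrak{g}'$. $\mathfrak{f}\Rightarrow_{\mathcal{D}}\mathfrak{f}'$ if $\mathfrak{f}'$ is obtained from $\mathfrak{f}$ by choosing a white node with subtree $\circ(\mathfrak{g})$ and replacing it by $\bullet(\mathfrak{g}\mathfrak{g})$; $\ll$ is its reflexive-transitive closure and $\mathcal{D}^*(\mathfrak{f}) = \{\mathfrak{f}' : \mathfrak{f}\ll\mathfrak{f}'\}$, which is a finite lattice for $\ll$; $[\mathfrak{f},\mathfrak{f}']$ denotes an interval. Let $\mathbb{K}$ be a field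 of characteristic zero; series are formal (possibly infinite) $\mathbb{K}$-linear combinations of forests or of tensors $\mathfrak{f}_1\otimes\cdots\otimes\mathfrak{f}_k$ of forests. The following operations are extended linearly: $\bar{\bullet}(\mathfrak{f}) = \bullet(\mathfrak{f})$ and, on tensors, $\bar{\bullet}(\mathfrak{f}_1\otimes\cdots\otimes\mathfrak{f}_k) = \bullet(\mathfrak{f}_1)\otimes\cdots\otimes\bullet(\mathfrak{f}_k)$; $\Delta(\mathfrak{f}) = \mathfrak{f}\otimes\mathfrak{f}$; $\mathrm{P}^2_{\odot}(\mathfrak{f}_1\otimes\mathfrak{f}_2) = \mathfrak{f}_1\mathfrak{f}_2$; $\mathbf{gr}(\mathfrak{f}) = \sum_{\mathfrak{f}'\in\mathcal{D}^*(\mathfrak{f})}\mathfrak{f}'$; $\mathbf{ns}(\mathfrak{f}) = \mathbf{gr}(\mathbf{gr}(\mathfrak{f})) = \sum_{\mathfrak{f}'\in\mathcal{D}^*(\mathfrak{f})}\#[\mathfrak{f},\mathfrak{f}']\,\mathfrak{f}'$; for $k\ge1$, $\mathbf{md}_k(\mathfrak{f}) = \sum \mathfrak{g}_1\otimes\cdots\otimes\mathfrak{g}_k$, the sum over all $\mathfrak{g}_1,\dots,\mathfrak{g}_k\in\mathcal{D}^*(\mathfrak{f})$ whose meet in the lattice $\mathcal{D}^*(\mathfrak{f})$ is $\mathfrak{f}$ (so $\mathbf{md}_1$ is the identity). For a word $u\in\{\circ,\bullet\}^k$ with $|u|_\bullet$ occurrences of $\bullet$, $\mathrm{mg}_u$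 is the linear map from $(k+|u|_\bullet)$-fold tensors to $k$-fold tensors defined recursively by $\mathrm{mg}_\circ(\mathfrak{f}_1) = \circ(\mathfrak{f}_1)$, $\mathrm{mg}_\bullet(\mathfrak{f}_1\otimes\mathfrak{f}_2) = \bullet(\mathfrak{f}_1\mathfrak{f}_2)$, $\mathrm{mg}_{\circ u'}(\mathfrak{f}_1\otimes\mathfrak{f}_2\otimes\cdots) = \circ(\mathfrak{f}_1)\otimes\mathrm{mg}_{u'}(\mathfrak{f}_2\otimes\cdots)$, and $\mathrm{mg}_{\bullet u'}(\mathfrak{f}_1\otimes\mathfrak{f}_2\otimes\mathfrak{f}_3\otimes\cdots) = \bullet(\mathfrak{f}_1\mathfrak{f}_2)\otimes\mathrm{mg}_{u'}(\mathfrak{f}_3\otimes\cdots)$. For $d\ge0$, $\mathfrak{l}_0=\epsilon$, $\mathfrak{l}_d=\circ(\mathfrak{l}_{d-1})$, and $\mathbf{ld}=\sum_{d\ge0}\mathfrak{l}_d$. -}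

module Defs where

open import Data.Nat using (ℕ; zero; suc)
open import Data.List using (List; []; _∷_; _++_)
open import Data.Vec using (Vec; []; _∷_; replicate; map)
open import Data.Vec.Relation.Unary.All using (All)
open import Data.Product using (Σ; _×_)
open import Data.Sum using (_⊎_)
open import Data.Irrelevant using (Irrelevant)
open import Relation.Binary.PropositionalEquality using (_≡_)
open import Relation.Binary.Construct.Closure.ReflexiveTransitive using (Star)

data Colour : Set where
  white black : Colour

data Tree : Set where
  node : Colour → List Tree → Tree

Forest : Set
Forest = List Tree

ε : Forest
ε = []

∘ᵗ : Forest → Tree
∘ᵗ g = node white g

•ᵗ : Forest → Tree
•ᵗ g = node black g

mutual
  data _⇒T_ : Tree → Tree → Set where
    dup    : ∀ {g} → ∘ᵗ g ⇒T •ᵗ (g ++ g)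
    inside : ∀ {c g g'} → g ⇒D g' → node c g ⇒T node c g'

  data _⇒D_ : Forest → Forest → Set where
    here  : ∀ {t t' f} → t ⇒T t' → (t ∷ f) ⇒D (t' ∷ f)
    there : ∀ {t f f'} → f ⇒D f' → (t ∷ f) ⇒D (t ∷ f')

_≪_ : Forest → Forest → Set
_≪_ = Star _⇒D_

-- Series with nonnegative-integer coefficients, represented
-- "combinatorially": the coefficient of an index x is the (finite)
-- set S x ; a sum of series is a disjoint union, a product of
-- coefficients a cartesian product.  Equality of series is a
-- coefficientwise bijection.  Proofs of ≪ are wrapped in Irrelevant so
-- that only forests (not rewriting paths) are counted.

Series : Set → Set₁
Series A = A → Set

push : ∀ {A B : Set} → (A → B) → Series A → Series B
push {A} F S b = Σ A (λ a → S a × (F a ≡ b))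

l : ℕ → Forest
l zero    = ε
l (suc d) = ∘ᵗ (l d) ∷ []

ld : Series Forest
ld f = Σ ℕ (λ d → l d ≡ f)

-- ns(f) = Σ_{f' ∈ D*(f)} #[f,f'] f'  , extended linearly
ns : Series Forest → Series Forest
ns S f' = Σ Forest (λ f → S f × Σ Forest (λ h → Irrelevant ((f ≪ h) × (h ≪ f'))))

MeetIs : ∀ {k} → Forest → Vec Forest k → Set
MeetIs {k} f gs = All (f ≪_) gs × ((h : Forest) → f ≪ h → All (h ≪_) gs → h ≪ f)

-- md_k , extended linearly (only used for k ≥ 1)
md : (k : ℕ) → Series Forest → Series (Vec Forest k)
md k S gs = Σ Forest (λ f → S f × Irrelevant (MeetIs f gs))

-- Δ(f) = f ⊗ f followed by P²_⊙ : f ↦ f f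
P⊙Δ : Series Forest → Series Forest
P⊙Δ = push (λ f → f ++ f)

bar• : ∀ {k} → Series (Vec Forest k) → Series (Vec Forest k)
bar• = push (map (λ f → •ᵗ f ∷ []))

-- arity of mg_u : k + |u|_•
len : ∀ {k} → Vec Colour k → ℕ
len []            = zero
len (white ∷ u)   = suc (len u)
len (black ∷ u)   = suc (suc (len u))

mg : ∀ {k} (u : Vec Colour k) → Vec Forest (len u) → Vec Forest k
mg []            []              = []
mg (white ∷ u)   (f ∷ fs)        = (∘ᵗ f ∷ []) ∷ mg u fs
mg (black ∷ u)   (f₁ ∷ f₂ ∷ fs)  = (•ᵗ (f₁ ++ f₂) ∷ []) ∷ mg u fs

εᵏ : (k : ℕ) → Series (Vec Forest k)
εᵏ k gs = replicate k ε ≡ gs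

md₁ : Series Forest → Series Forest
md₁ S g = md 1 S (g ∷ [])

-- The order ≪ has a structural description ≤F: forests are compared tree by tree, and a
-- white node ∘(a) lies below •(b₁ b₂) exactly when a lies below both b₁ and b₂.  This makes
-- meets computable: the meet of g₁, …, g_k in D*(h), for a common lower bound h, is obtained
-- by walking along h and keeping a white node white unless it is black in every gᵢ.  Hence a
-- term f₀ ≪ h ≪ f of md_k(ns S), f being the meet of the gᵢ, is determined by f₀ ∈ S and the
-- common lower bound h, and md_k(ns S) counts such pairs.  For S = ld we have f₀ = l_d, so
-- h is ε (giving ε^{⊗k}), or a single white root ∘(c) with l_{d-1} ≪ c, in which case the gᵢ
-- are mg_u of common upper bounds of c (the mg_u terms), or a single black root •(c) with
-- l_{d-1} l_{d-1} ≪ c, in which case gᵢ = •(yᵢ) with the yᵢ above c (the \bar• term).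
module Submission where

open import Axiom.UniquenessOfIdentityProofs using (module Decidable⇒UIP)
open import Data.Bool using (Bool; true; false)
open import Data.Empty using (⊥-elim; ⊥-elim-irr)
open import Data.Irrelevant using (Irrelevant; [_])
open import Data.List using (List; []; _∷_; _++_; length; take; drop; map)
open import Data.List.Properties using (length-++; take++drop≡id; take-all)
import Data.List.Relation.Unary.All as L
open import Data.List.Relation.Unary.All.Properties using (map⁺)
open import Data.Nat using (ℕ; zero; suc; _+_)
import Data.Nat as ℕ
open import Data.Nat.Properties using (+-suc; suc-injective; ≤-reflexive)
open import Data.Product using (Σ; _×_; _,_; proj₁; proj₂; uncurry)
import Data.Product as Product
open import Data.Product.Algebra using (Σ-assoc-alt; ×-cong; ×-identityˡ)
open import Data.Product.Function.Dependent.Propositional using (Σ-↔)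
open import Data.Sum using (_⊎_; inj₁; inj₂)
open import Data.Sum.Function.Propositional using (_⊎-↔_)
open import Data.Unit.Polymorphic using (⊤; tt)
open import Data.Vec using (Vec; []; _∷_; toList; replicate)
import Data.Vec as Vec
open import Data.Vec.Properties using (≡-dec; map-∘; map-id)
open import Data.Vec.Relation.Unary.All using (All; []; _∷_)
import Data.Vec.Relation.Unary.All as VecAll
open import Data.Vec.Relation.Unary.All.Properties using (toList⁺; toList⁻)
import Data.Vec.Relation.Unary.All.Properties as VecAllₚ
open import Function using (_∘_)
open import Function.Bundles using (_↔_; mk↔ₛ′)
open import Function.Properties.Inverse using (↔-refl; ↔-sym; ↔-trans)
open import Level using (0ℓ)
open import Relation.Binary.Construct.Closure.ReflexiveTransitive using (Star; _◅_; _◅◅_; gmap)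
  renaming (ε to ε★)
open import Relation.Binary.Definitions using (DecidableEquality)
open import Relation.Binary.PropositionalEquality
open import Relation.Nullary using (¬_; yes; no)
open import Relation.Nullary.Decidable using (recompute; _×-dec_)
import Relation.Nullary.Decidable as Dec

open import Defs

+-double-injective : ∀ m n → m + m ≡ n + n → m ≡ n
+-double-injective zero    zero    e = refl
+-double-injective (suc m) (suc n) e rewrite +-suc m m | +-suc n n =
  cong suc (+-double-injective m n (suc-injective (suc-injective e)))

take-++ : ∀ {A : Set} {n} (xs ys : List A) → length xs ≡ n → take n (xs ++ ys) ≡ xs
take-++ []       ys refl = refl
take-++ (x ∷ xs) ys refl = cong (x ∷_) (take-++ xs ys refl)

drop-++ : ∀ {A : Set} {n} (xs ys : List A) → length xs ≡ n → drop n (xs ++ ys) ≡ ys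
drop-++ []       ys refl = refl
drop-++ (x ∷ xs) ys refl = drop-++ xs ys refl

Σ-≡-prop : ∀ {A : Set} {B : A → Set} → (∀ {a} (x y : B a) → x ≡ y) →
           ∀ {a a' x y} → a ≡ a' → _≡_ {A = Σ A B} (a , x) (a' , y)
Σ-≡-prop B-prop refl = cong (_ ,_) (B-prop _ _)

Σ-cong : ∀ {A : Set} {B C : A → Set} → (∀ a → B a ↔ C a) → Σ A B ↔ Σ A C
Σ-cong B↔C = Σ-↔ ↔-refl (B↔C _)

Σ-×-Σ-interchange : ∀ {C Y : Set} {A : C → Set} {B : C → Y → Set} {E : Y → Set} →
  Σ C (λ c → A c × Σ Y λ y → B c y × E y) ↔ Σ Y (λ y → Σ C (λ c → A c × B c y) × E y)
Σ-×-Σ-interchange = mk↔ₛ′ (λ { (c , a , y , b , e) → y , (c , a , b) , e })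
                          (λ { (y , (c , a , b) , e) → c , a , y , b , e })
                          (λ _ → refl) (λ _ → refl)

-- The order ≪, described structurally

infix 4 _≤T_ _≤F_

data _≤T_ : Tree → Tree → Set
data _≤F_ : Forest → Forest → Set

data _≤T_ where
  ∘≤∘ : ∀ {a b} → a ≤F b → ∘ᵗ a ≤T ∘ᵗ b
  •≤• : ∀ {a b} → a ≤F b → •ᵗ a ≤T •ᵗ b
  ∘≤• : ∀ {a b₁ b₂} → a ≤F b₁ → a ≤F b₂ → ∘ᵗ a ≤T •ᵗ (b₁ ++ b₂)

data _≤F_ where
  []  : [] ≤F []
  _∷_ : ∀ {t t' f f'} → t ≤T t' → f ≤F f' → t ∷ f ≤F t' ∷ f'

≤T-refl : ∀ t → t ≤T t
≤F-refl : ∀ f → f ≤F f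
≤T-refl (node white a) = ∘≤∘ (≤F-refl a)
≤T-refl (node black a) = •≤• (≤F-refl a)
≤F-refl []      = []
≤F-refl (t ∷ f) = ≤T-refl t ∷ ≤F-refl f

≤F⇒length≡ : ∀ {a b} → a ≤F b → length a ≡ length b
≤F⇒length≡ []      = refl
≤F⇒length≡ (_ ∷ p) = cong suc (≤F⇒length≡ p)

≤F-++ : ∀ {a b c d} → a ≤F b → c ≤F d → a ++ c ≤F b ++ d
≤F-++ []      q = q
≤F-++ (x ∷ p) q = x ∷ ≤F-++ p q

≤F-++-split : ∀ a {a' c} → a ++ a' ≤F c →
              Σ Forest λ c₁ → Σ Forest λ c₂ → c ≡ c₁ ++ c₂ × a ≤F c₁ × a' ≤F c₂
≤F-++-split []      p = [] , _ , refl , [] , p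
≤F-++-split (_ ∷ a) (x ∷ p) with ≤F-++-split a p
... | c₁ , c₂ , refl , q , r = _ ∷ c₁ , c₂ , refl , x ∷ q , r

≤F-take : ∀ n {a b} → a ≤F b → take n a ≤F take n b
≤F-take zero    p       = []
≤F-take (suc n) []      = []
≤F-take (suc n) (x ∷ p) = x ∷ ≤F-take n p

≤F-drop : ∀ n {a b} → a ≤F b → drop n a ≤F drop n b
≤F-drop zero    p       = p
≤F-drop (suc n) []      = []
≤F-drop (suc n) (x ∷ p) = ≤F-drop n p

children : Tree → Forest
children (node _ f) = f

≤F-head : ∀ {t t' f f'} → t ∷ f ≤F t' ∷ f' → t ≤T t'
≤F-head (p ∷ _) = p

•≤•⁻¹ : ∀ {c t} → •ᵗ c ≤T t → c ≤F children t
•≤•⁻¹ (•≤• p) = p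

∘≤∘⁻¹ : ∀ {a b} → ∘ᵗ a ≤T ∘ᵗ b → a ≤F b
∘≤∘⁻¹ (∘≤∘ p) = p

∘≤•′ : ∀ {a b} → a ++ a ≤F b → ∘ᵗ a ≤T •ᵗ b
∘≤•′ {a} p with ≤F-++-split a p
... | _ , _ , refl , q , r = ∘≤• q r

∘≤•⁻¹ : ∀ {a b} → ∘ᵗ a ≤T •ᵗ b → a ++ a ≤F b
∘≤•⁻¹ (∘≤• p q) = ≤F-++ p q

[]≰∷ : ∀ {t f} → ¬ ([] ≤F t ∷ f)
[]≰∷ ()

∷≰[] : ∀ {t f} → ¬ (t ∷ f ≤F [])
∷≰[] ()

⇒T-≤T-trans : ∀ {a b c} → a ⇒T b → b ≤T c → a ≤T c
⇒D-≤F-trans : ∀ {a b c} → a ⇒D b → b ≤F c → a ≤F c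
⇒T-≤T-trans dup        (•≤• p)   = ∘≤•′ p
⇒T-≤T-trans (inside s) (∘≤∘ p)   = ∘≤∘ (⇒D-≤F-trans s p)
⇒T-≤T-trans (inside s) (•≤• p)   = •≤• (⇒D-≤F-trans s p)
⇒T-≤T-trans (inside s) (∘≤• p q) = ∘≤• (⇒D-≤F-trans s p) (⇒D-≤F-trans s q)
⇒D-≤F-trans (here s)  (p ∷ ps) = ⇒T-≤T-trans s p ∷ ps
⇒D-≤F-trans (there s) (p ∷ ps) = p ∷ ⇒D-≤F-trans s ps

≪⇒≤F : ∀ {a b} → a ≪ b → a ≤F b
≪⇒≤F {a} ε★       = ≤F-refl a
≪⇒≤F     (s ◅ ss) = ⇒D-≤F-trans s (≪⇒≤F ss)

≪-node : ∀ {c a b} → a ≪ b → Star _⇒T_ (node c a) (node c b)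
≪-node = gmap _ inside

≪-++ˡ : ∀ {a a'} c → a ≪ a' → (a ++ c) ≪ (a' ++ c)
≪-++ˡ c = gmap _ (step c)
  where
  step : ∀ {a a'} c → a ⇒D a' → (a ++ c) ⇒D (a' ++ c)
  step c (here s)  = here s
  step c (there s) = there (step c s)

≪-++ʳ : ∀ a {c c'} → c ≪ c' → (a ++ c) ≪ (a ++ c')
≪-++ʳ a = gmap _ (step a)
  where
  step : ∀ a {c c'} → c ⇒D c' → (a ++ c) ⇒D (a ++ c')
  step []      s = s
  step (_ ∷ a) s = there (step a s)

≪-++ : ∀ {a a' c c'} → a ≪ a' → c ≪ c' → (a ++ c) ≪ (a' ++ c')
≪-++ {a' = a'} {c = c} p q = ≪-++ˡ c p ◅◅ ≪-++ʳ a' q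

≤T⇒≪ : ∀ {a b} → a ≤T b → Star _⇒T_ a b
≤F⇒≪ : ∀ {a b} → a ≤F b → a ≪ b
≤T⇒≪ (∘≤∘ p)   = ≪-node (≤F⇒≪ p)
≤T⇒≪ (•≤• p)   = ≪-node (≤F⇒≪ p)
≤T⇒≪ (∘≤• p q) = dup ◅ ≪-node (≪-++ (≤F⇒≪ p) (≤F⇒≪ q))
≤F⇒≪ []       = ε★
≤F⇒≪ (p ∷ ps) = gmap _ here (≤T⇒≪ p) ◅◅ gmap _ there (≤F⇒≪ ps)

≤F-trans : ∀ {a b c} → a ≤F b → b ≤F c → a ≤F c
≤F-trans p q = ≪⇒≤F (≤F⇒≪ p ◅◅ ≤F⇒≪ q)

≤T-antisym : ∀ {a b} → a ≤T b → b ≤T a → a ≡ b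
≤F-antisym : ∀ {a b} → a ≤F b → b ≤F a → a ≡ b
≤T-antisym (∘≤∘ p) (∘≤∘ q) = cong ∘ᵗ (≤F-antisym p q)
≤T-antisym (•≤• p) (•≤• q) = cong •ᵗ (≤F-antisym p q)
≤F-antisym []       []       = refl
≤F-antisym (p ∷ ps) (q ∷ qs) = cong₂ _∷_ (≤T-antisym p q) (≤F-antisym ps qs)

-- Meets

headTree : Forest → Tree
headTree []      = ∘ᵗ []
headTree (t ∷ _) = t

allBlack : List Tree → Bool
allBlack []                  = true
allBlack (node white _ ∷ _)  = false
allBlack (node black _ ∷ ts) = allBlack ts

blocks : ℕ → List Tree → List Forest
blocks n []                  = []
blocks n (node white g ∷ ts) = g ∷ blocks n ts
blocks n (node black g ∷ ts) = take n g ∷ drop n g ∷ blocks n ts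

-- glbF h gs is the meet of gs in D*(h) when gs is nonempty and h ≤F every member; as h fixes
-- the shape of every gᵢ, the junk value of headTree on ε is never inspected.
glbT : Tree → List Tree → Tree
glbF : Forest → List Forest → Forest
glb∘ : Forest → List Tree → Bool → Tree
glbT (node black c) ts = •ᵗ (glbF c (map children ts))
glbT (node white c) ts = glb∘ c ts (allBlack ts)
glb∘ c ts true  = •ᵗ (glbF c (map (take (length c) ∘ children) ts)
                     ++ glbF c (map (drop (length c) ∘ children) ts))
glb∘ c ts false = ∘ᵗ (glbF c (blocks (length c) ts))
glbF []      gs = []
glbF (x ∷ h) gs = glbT x (map headTree gs) ∷ glbF h (map (drop 1) gs)

∘≤⇒≤take : ∀ {c t} n → length c ≡ n → ∘ᵗ c ≤T t → c ≤F take n (children t)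
∘≤⇒≤take n e (∘≤∘ p)   =
  subst (_ ≤F_) (sym (take-all n _ (≤-reflexive (trans (sym (≤F⇒length≡ p)) e)))) p
∘≤⇒≤take n e (∘≤• p q) = subst (_ ≤F_) (sym (take-++ _ _ (trans (sym (≤F⇒length≡ p)) e))) p

∘≤•⇒≤drop : ∀ {c b} n → length c ≡ n → ∘ᵗ c ≤T •ᵗ b → c ≤F drop n b
∘≤•⇒≤drop n e (∘≤• p q) = subst (_ ≤F_) (sym (drop-++ _ _ (trans (sym (≤F⇒length≡ p)) e))) q

children-lb : ∀ {c ts} → L.All (•ᵗ c ≤T_) ts → L.All (c ≤F_) (map children ts)
children-lb = map⁺ ∘ L.map •≤•⁻¹

take-lb : ∀ {c ts} n → length c ≡ n → L.All (∘ᵗ c ≤T_) ts → L.All (c ≤F_) (map (take n ∘ children) ts)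
take-lb n e = map⁺ ∘ L.map (∘≤⇒≤take n e)

drop-lb : ∀ {c ts} n → length c ≡ n → allBlack ts ≡ true →
          L.All (∘ᵗ c ≤T_) ts → L.All (c ≤F_) (map (drop n ∘ children) ts)
drop-lb {ts = []}                 n e b L.[]       = L.[]
drop-lb {ts = node black _ ∷ ts} n e b (p L.∷ ps) = ∘≤•⇒≤drop n e p L.∷ drop-lb n e b ps

blocks-lb : ∀ {c ts} n → length c ≡ n → L.All (∘ᵗ c ≤T_) ts → L.All (c ≤F_) (blocks n ts)
blocks-lb n e L.[]                = L.[]
blocks-lb n e (∘≤∘ p L.∷ ps)      = p L.∷ blocks-lb n e ps
blocks-lb n e (p@(∘≤• _ _) L.∷ ps) = ∘≤⇒≤take n e p L.∷ ∘≤•⇒≤drop n e p L.∷ blocks-lb n e ps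

children-join : ∀ {c m ts} → L.All (•ᵗ c ≤T_) ts → L.All (m ≤F_) (map children ts) → L.All (•ᵗ m ≤T_) ts
children-join L.[]           L.[]       = L.[]
children-join (•≤• _ L.∷ ps) (q L.∷ qs) = •≤• q L.∷ children-join ps qs

halves-join : ∀ {m₁ m₂ ts} n → allBlack ts ≡ true →
              L.All (m₁ ≤F_) (map (take n ∘ children) ts) → L.All (m₂ ≤F_) (map (drop n ∘ children) ts) →
              L.All (•ᵗ (m₁ ++ m₂) ≤T_) ts
halves-join {ts = []}                n _ L.[]       L.[]       = L.[]
halves-join {ts = node black b ∷ ts} n e (p L.∷ ps) (q L.∷ qs) =
  •≤• (subst (_ ≤F_) (take++drop≡id n b) (≤F-++ p q)) L.∷ halves-join n e ps qs

blocks-join : ∀ {c m ts} → L.All (∘ᵗ c ≤T_) ts → L.All (m ≤F_) (blocks (length c) ts) → L.All (∘ᵗ m ≤T_) ts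
blocks-join L.[]           L.[]       = L.[]
blocks-join (∘≤∘ _ L.∷ ps) (q L.∷ qs) = ∘≤∘ q L.∷ blocks-join ps qs
blocks-join (∘≤• {b₁ = b₁} {b₂} p _ L.∷ ps) (q₁ L.∷ q₂ L.∷ qs) =
  ∘≤• (subst (_ ≤F_) (take-++ b₁ b₂ (sym (≤F⇒length≡ p))) q₁)
      (subst (_ ≤F_) (drop-++ b₁ b₂ (sym (≤F⇒length≡ p))) q₂) L.∷ blocks-join ps qs

∷-lb-split : ∀ {x h gs} → L.All ((x ∷ h) ≤F_) gs →
             L.All (x ≤T_) (map headTree gs) × L.All (h ≤F_) (map (drop 1) gs)
∷-lb-split L.[]              = L.[] , L.[]
∷-lb-split ((p ∷ q) L.∷ pqs) = p L.∷ proj₁ (∷-lb-split pqs) , q L.∷ proj₂ (∷-lb-split pqs)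

∷-lb-join : ∀ {x h a b gs} → L.All ((x ∷ h) ≤F_) gs →
            L.All (a ≤T_) (map headTree gs) → L.All (b ≤F_) (map (drop 1) gs) → L.All ((a ∷ b) ≤F_) gs
∷-lb-join L.[]              L.[]       L.[]       = L.[]
∷-lb-join ((_ ∷ _) L.∷ pqs) (p L.∷ ps) (q L.∷ qs) = (p ∷ q) L.∷ ∷-lb-join pqs ps qs

glbT-lowerBound : ∀ x ts → L.All (x ≤T_) ts → L.All (glbT x ts ≤T_) ts
glbF-lowerBound : ∀ h gs → L.All (h ≤F_) gs → L.All (glbF h gs ≤F_) gs
glbT-lowerBound (node black c) ts p = children-join p (glbF-lowerBound c _ (children-lb p))
glbT-lowerBound (node white c) ts p with allBlack ts in e
... | true  = halves-join (length c) e (glbF-lowerBound c _ (take-lb _ refl p))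
                                       (glbF-lowerBound c _ (drop-lb _ refl e p))
... | false = blocks-join p (glbF-lowerBound c _ (blocks-lb _ refl p))
glbF-lowerBound []      gs p = p
glbF-lowerBound (x ∷ h) gs p =
  ∷-lb-join p (glbT-lowerBound x _ (proj₁ (∷-lb-split p))) (glbF-lowerBound h _ (proj₂ (∷-lb-split p)))

∘≤-length-unique : ∀ {c c' t} → ∘ᵗ c ≤T t → ∘ᵗ c' ≤T t → length c ≡ length c'
∘≤-length-unique {t = node white _} (∘≤∘ p) (∘≤∘ q) = trans (≤F⇒length≡ p) (sym (≤F⇒length≡ q))
∘≤-length-unique {c} {c'} {node black _} p q = +-double-injective (length c) (length c') (begin
  length c + length c    ≡⟨ length-++ c ⟨
  length (c ++ c)        ≡⟨ ≤F⇒length≡ (∘≤•⁻¹ p) ⟩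
  _                      ≡⟨ ≤F⇒length≡ (∘≤•⁻¹ q) ⟨
  length (c' ++ c')      ≡⟨ length-++ c' ⟩
  length c' + length c'  ∎)
  where open ≡-Reasoning

•≤-allBlack : ∀ {c ts} → L.All (•ᵗ c ≤T_) ts → allBlack ts ≡ true
•≤-allBlack L.[]           = refl
•≤-allBlack (•≤• _ L.∷ ps) = •≤-allBlack ps

∘≤⇒≤children : ∀ {c c' t} → •ᵗ c ≤T t → ∘ᵗ c' ≤T t → c' ++ c' ≤F children t
∘≤⇒≤children (•≤• _) q = ∘≤•⁻¹ q

glbT-greatest : ∀ x t ts x' → L.All (x ≤T_) (t ∷ ts) → L.All (x' ≤T_) (t ∷ ts) → x' ≤T glbT x (t ∷ ts)
glbF-greatest : ∀ h g gs h' → L.All (h ≤F_) (g ∷ gs) → L.All (h' ≤F_) (g ∷ gs) → h' ≤F glbF h (g ∷ gs)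
glbT-greatest (node black c) _ _ (node black c') p p' =
  •≤• (glbF-greatest c _ _ c' (children-lb p) (children-lb p'))
glbT-greatest (node black c) _ _ (node white c') p p' =
  ∘≤•′ (glbF-greatest c _ _ (c' ++ c') (children-lb p) (map⁺ (L.zipWith (uncurry ∘≤⇒≤children) (p , p'))))
glbT-greatest (node white c) (node white _) _ (node black c') p (() L.∷ _)
glbT-greatest (node white c) (node black _) ts (node black c') p p' with allBlack ts in e
... | true  = •≤• (subst (_≤F _) (take++drop≡id (length c) c') (≤F-++
                (glbF-greatest c _ _ _ (take-lb _ refl p) (map⁺ (L.map (≤F-take (length c) ∘ •≤•⁻¹) p')))
                (glbF-greatest c _ _ _ (drop-lb _ refl e p) (map⁺ (L.map (≤F-drop (length c) ∘ •≤•⁻¹) p')))))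
... | false with () ← trans (sym (•≤-allBlack p')) e
glbT-greatest (node white c) (node white _) _ (node white c') p@(q L.∷ _) p'@(q' L.∷ _) =
  ∘≤∘ (glbF-greatest c _ _ c' (blocks-lb _ refl p) (blocks-lb _ (sym (∘≤-length-unique q q')) p'))
glbT-greatest (node white c) (node black _) ts (node white c') p@(q L.∷ _) p'@(q' L.∷ _)
  with allBlack ts in e
... | true  = ∘≤• (glbF-greatest c _ _ c' (take-lb _ refl p) (take-lb _ (sym (∘≤-length-unique q q')) p'))
                  (glbF-greatest c _ _ c' (drop-lb _ refl e p) (drop-lb _ (sym (∘≤-length-unique q q')) e p'))
... | false = ∘≤∘ (glbF-greatest c _ _ c' (blocks-lb _ refl p) (blocks-lb _ (sym (∘≤-length-unique q q')) p'))
glbF-greatest []      _ _ h' ([] L.∷ _) ([] L.∷ _) = []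
glbF-greatest (x ∷ h) _ _ (x' ∷ h') p@((_ ∷ _) L.∷ _) p'@((_ ∷ _) L.∷ _) =
  glbT-greatest x _ _ x' (proj₁ (∷-lb-split p)) (proj₁ (∷-lb-split p'))
  ∷ glbF-greatest h _ _ h' (proj₂ (∷-lb-split p)) (proj₂ (∷-lb-split p'))

meet : ∀ {n} → Forest → Vec Forest (suc n) → Forest
meet h gs = glbF h (toList gs)

meet-lowerBound : ∀ {n h} {gs : Vec Forest (suc n)} → All (h ≤F_) gs → All (meet h gs ≤F_) gs
meet-lowerBound h≤gs = toList⁻ (glbF-lowerBound _ _ (toList⁺ h≤gs))

meet-greatest : ∀ {n h h'} {gs : Vec Forest (suc n)} → All (h ≤F_) gs → All (h' ≤F_) gs → h' ≤F meet h gs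
meet-greatest {gs = _ ∷ _} h≤gs h'≤gs = glbF-greatest _ _ _ _ (toList⁺ h≤gs) (toList⁺ h'≤gs)

meet-isMeet : ∀ {n h} {gs : Vec Forest (suc n)} → All (h ≤F_) gs → MeetIs (meet h gs) gs
meet-isMeet h≤gs =
  VecAll.map ≤F⇒≪ (meet-lowerBound h≤gs) , λ _ _ h'≪gs → ≤F⇒≪ (meet-greatest h≤gs (VecAll.map ≪⇒≤F h'≪gs))

meet-unique : ∀ {n h f} {gs : Vec Forest (suc n)} → h ≤F f → MeetIs f gs → meet h gs ≡ f
meet-unique {h = h} {f} {gs} h≤f (f≪gs , f-greatest) = ≤F-antisym m≤f f≤m
  where
  h≤gs : All (h ≤F_) gs
  h≤gs = VecAll.map (≤F-trans h≤f ∘ ≪⇒≤F) f≪gs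
  f≤m : f ≤F meet h gs
  f≤m = meet-greatest h≤gs (VecAll.map ≪⇒≤F f≪gs)
  m≤f : meet h gs ≤F f
  m≤f = ≪⇒≤F (f-greatest _ (≤F⇒≪ f≤m) (VecAll.map ≤F⇒≪ (meet-lowerBound h≤gs)))

-- md_k (ns S) as a sum over common lower bounds

gr : Series Forest → Series Forest
gr S h = Σ Forest λ f → S f × Irrelevant (f ≤F h)

lowerBounds : ∀ {k} → Series Forest → Series (Vec Forest k)
lowerBounds S gs = Σ Forest λ h → gr S h × Irrelevant (All (h ≤F_) gs)

_≟C_ : DecidableEquality Colour
white ≟C white = yes refl
white ≟C black = no λ ()
black ≟C white = no λ ()
black ≟C black = yes refl

_≟T_ : DecidableEquality Tree
_≟F_ : DecidableEquality Forest
node c f ≟T node c' f' =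
  Dec.map′ (uncurry (cong₂ node)) (λ { refl → refl , refl }) (c ≟C c' ×-dec f ≟F f')
[]      ≟F []        = yes refl
[]      ≟F (_ ∷ _)   = no λ ()
(_ ∷ _) ≟F []        = no λ ()
(t ∷ f) ≟F (t' ∷ f') =
  Dec.map′ (uncurry (cong₂ _∷_)) (λ { refl → refl , refl }) (t ≟T t' ×-dec f ≟F f')

md-ns↔lowerBounds : ∀ S {n} (gs : Vec Forest (suc n)) → md (suc n) (ns S) gs ↔ lowerBounds S gs
md-ns↔lowerBounds S {n} gs = mk↔ₛ′ to from (λ _ → refl) from∘to
  where
  to : md (suc n) (ns S) gs → lowerBounds S gs
  to (f , (f₀ , s , h , [ f₀≪h≪f ]) , [ f-meet ]) =
    h , (f₀ , s , [ ≪⇒≤F (proj₁ f₀≪h≪f) ]) ,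
    [ VecAll.map (≤F-trans (≪⇒≤F (proj₂ f₀≪h≪f)) ∘ ≪⇒≤F) (proj₁ f-meet) ]

  from : lowerBounds S gs → md (suc n) (ns S) gs
  from (h , (f₀ , s , [ f₀≤h ]) , [ h≤gs ]) =
    meet h gs , (f₀ , s , h , [ ≤F⇒≪ f₀≤h , ≤F⇒≪ (meet-greatest h≤gs h≤gs) ]) , [ meet-isMeet h≤gs ]

  replace-meet : ∀ {f f' f₀ s h} → f ≡ f' → .{x : (f₀ ≪ h) × (h ≪ f)} .{y : MeetIs f gs}
                 .{x' : (f₀ ≪ h) × (h ≪ f')} .{y' : MeetIs f' gs} →
                 _≡_ {A = md (suc n) (ns S) gs} (f , (f₀ , s , h , [ x ]) , [ y ]) (f' , (f₀ , s , h , [ x' ]) , [ y' ])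
  replace-meet refl = refl

  -- The equation meet h gs ≡ f is only available irrelevantly; decidable equality recovers it.
  from∘to : ∀ x → from (to x) ≡ x
  from∘to (f , (f₀ , s , h , [ f₀≪h≪f ]) , [ f-meet ]) =
    replace-meet (recompute (meet h gs ≟F f) (meet-unique (≪⇒≤F (proj₂ f₀≪h≪f)) f-meet))

ns↔lowerBounds : ∀ S g → ns S g ↔ lowerBounds S (g ∷ [])
ns↔lowerBounds S g = mk↔ₛ′
  (λ { (f₀ , s , h , [ f₀≪h≪g ]) → h , (f₀ , s , [ ≪⇒≤F (proj₁ f₀≪h≪g) ]) , [ ≪⇒≤F (proj₂ f₀≪h≪g) ∷ [] ] })
  (λ { (h , (f₀ , s , [ f₀≤h ]) , [ h≤g ]) → f₀ , s , h , [ ≤F⇒≪ f₀≤h , ≤F⇒≪ (VecAll.head h≤g) ] })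
  (λ _ → refl) (λ _ → refl)

-- The series ld

∘¹ •¹ : Forest → Forest
∘¹ f = ∘ᵗ f ∷ []
•¹ f = •ᵗ f ∷ []

l≰∷∷ : ∀ d {t t' f} → ¬ (l d ≤F t ∷ t' ∷ f)
l≰∷∷ (suc d) (_ ∷ ())

gr-ld-∷∷ : ∀ {t t' f} → ¬ gr ld (t ∷ t' ∷ f)
gr-ld-∷∷ (_ , (d , refl) , [ p ]) = ⊥-elim-irr (l≰∷∷ d p)

gr-ld-[] : gr ld [] ↔ ⊤ {0ℓ}
gr-ld-[] = mk↔ₛ′ (λ _ → tt) (λ _ → ε-witness) (λ _ → refl) ε-witness-unique
  where
  ε-witness : gr ld []
  ε-witness = ε , (0 , refl) , [ [] ]

  ε-witness-unique : ∀ x → ε-witness ≡ x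
  ε-witness-unique (_ , (zero  , refl) , _)     = refl
  ε-witness-unique (_ , (suc d , refl) , [ p ]) = ⊥-elim-irr (∷≰[] p)

gr-ld-∘ : ∀ c → gr ld (∘¹ c) ↔ gr ld c
gr-ld-∘ c = mk↔ₛ′ to from (λ { (_ , (_ , refl) , _) → refl }) from∘to
  where
  to : gr ld (∘¹ c) → gr ld c
  to (_ , (zero  , refl) , [ p ]) = ⊥-elim-irr ([]≰∷ p)
  to (_ , (suc d , refl) , [ p ]) = l d , (d , refl) , [ ∘≤∘⁻¹ (≤F-head p) ]

  from : gr ld c → gr ld (∘¹ c)
  from (_ , (d , refl) , [ p ]) = l (suc d) , (suc d , refl) , [ ∘≤∘ p ∷ [] ]

  from∘to : ∀ x → from (to x) ≡ x
  from∘to (_ , (zero  , refl) , [ p ]) = ⊥-elim-irr ([]≰∷ p)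
  from∘to (_ , (suc d , refl) , _)     = refl

gr-ld-• : ∀ c → gr ld (•¹ c) ↔ gr (P⊙Δ ld) c
gr-ld-• c = mk↔ₛ′ to from (λ { (_ , (_ , (_ , refl) , refl) , _) → refl }) from∘to
  where
  to : gr ld (•¹ c) → gr (P⊙Δ ld) c
  to (_ , (zero  , refl) , [ p ]) = ⊥-elim-irr ([]≰∷ p)
  to (_ , (suc d , refl) , [ p ]) = l d ++ l d , (l d , (d , refl) , refl) , [ ∘≤•⁻¹ (≤F-head p) ]

  from : gr (P⊙Δ ld) c → gr ld (•¹ c)
  from (_ , (_ , (d , refl) , refl) , [ p ]) = l (suc d) , (suc d , refl) , [ ∘≤•′ p ∷ [] ]

  from∘to : ∀ x → from (to x) ≡ x
  from∘to (_ , (zero  , refl) , [ p ]) = ⊥-elim-irr ([]≰∷ p)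
  from∘to (_ , (suc d , refl) , _)     = refl

vec-≡-irrelevant : ∀ {n} {xs ys : Vec Forest n} (p q : xs ≡ ys) → p ≡ q
vec-≡-irrelevant = Decidable⇒UIP.≡-irrelevant (≡-dec _≟F_)

Irrelevant×≡-prop : ∀ {P : Set} {n} {xs ys : Vec Forest n} (x y : Irrelevant P × xs ≡ ys) → x ≡ y
Irrelevant×≡-prop (_ , p) (_ , q) = cong (_ ,_) (vec-≡-irrelevant p q)

≥[]⇒≡replicate : ∀ {k} {gs : Vec Forest k} → All ([] ≤F_) gs → replicate k ε ≡ gs
≥[]⇒≡replicate []        = refl
≥[]⇒≡replicate ([] ∷ ps) = cong (ε ∷_) (≥[]⇒≡replicate ps)

[]≤replicate : ∀ k → All ([] ≤F_) (replicate k ε)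
[]≤replicate zero    = []
[]≤replicate (suc k) = [] ∷ []≤replicate k

[]-lb↔εᵏ : ∀ {k} (gs : Vec Forest k) → Irrelevant (All ([] ≤F_) gs) ↔ εᵏ k gs
[]-lb↔εᵏ {k} gs = mk↔ₛ′
  (λ { [ p ] → recompute (≡-dec _≟F_ (replicate k ε) gs) (≥[]⇒≡replicate p) })
  (λ e → [ subst (All ([] ≤F_)) e ([]≤replicate k) ])
  (λ _ → vec-≡-irrelevant _ _) (λ _ → refl)

Mg : ℕ → Set
Mg k = Σ (Vec Colour k) λ u → Vec Forest (len u)

unmg : ∀ {k} → ℕ → Vec Forest k → Mg k
unmg n []                        = [] , []
unmg n ([] ∷ gs)                 = Product.map (white ∷_) (ε ∷_) (unmg n gs)
unmg n ((node white c ∷ _) ∷ gs) = Product.map (white ∷_) (c ∷_) (unmg n gs)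
unmg n ((node black b ∷ _) ∷ gs) = Product.map (black ∷_) (λ ys → take n b ∷ drop n b ∷ ys) (unmg n gs)

unmg-mg : ∀ {k n} (u : Vec Colour k) ys → All (λ y → length y ≡ n) ys → unmg n (mg u ys) ≡ (u , ys)
unmg-mg []          []             []              = refl
unmg-mg (white ∷ u) (y ∷ ys)       (_ ∷ ls)        rewrite unmg-mg u ys ls = refl
unmg-mg (black ∷ u) (y₁ ∷ y₂ ∷ ys) (l₁ ∷ _ ∷ ls)
  rewrite unmg-mg u ys ls | take-++ y₁ y₂ l₁ | drop-++ y₁ y₂ l₁ = refl

mg-unmg : ∀ {k c} {gs : Vec Forest k} → All (∘¹ c ≤F_) gs → uncurry mg (unmg (length c) gs) ≡ gs
mg-unmg []                  = refl
mg-unmg ((∘≤∘ _ ∷ []) ∷ ps) = cong (_ ∷_) (mg-unmg ps)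
mg-unmg {c = c} ((∘≤• {b₁ = b₁} {b₂} _ _ ∷ []) ∷ ps) =
  cong₂ _∷_ (cong •¹ (take++drop≡id (length c) (b₁ ++ b₂))) (mg-unmg ps)

unmg-lb : ∀ {k c} {gs : Vec Forest k} → All (∘¹ c ≤F_) gs → All (c ≤F_) (proj₂ (unmg (length c) gs))
unmg-lb []                        = []
unmg-lb ((∘≤∘ p ∷ []) ∷ ps)       = p ∷ unmg-lb ps
unmg-lb ((p@(∘≤• _ _) ∷ []) ∷ ps) = ∘≤⇒≤take _ refl p ∷ ∘≤•⇒≤drop _ refl p ∷ unmg-lb ps

mg-lb : ∀ {k c} (u : Vec Colour k) ys → All (c ≤F_) ys → All (∘¹ c ≤F_) (mg u ys)
mg-lb []          []             []             = []
mg-lb (white ∷ u) (_ ∷ ys)       (p ∷ ps)       = (∘≤∘ p ∷ []) ∷ mg-lb u ys ps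
mg-lb (black ∷ u) (_ ∷ _ ∷ ys)   (p ∷ q ∷ ps)   = (∘≤• p q ∷ []) ∷ mg-lb u ys ps

∘-lb↔mg : ∀ {k} c (gs : Vec Forest k) →
          Irrelevant (All (∘¹ c ≤F_) gs)
            ↔ Σ (Mg k) λ uys → Irrelevant (All (c ≤F_) (proj₂ uys)) × uncurry mg uys ≡ gs
∘-lb↔mg {k} c gs = mk↔ₛ′ to from to∘from (λ _ → refl)
  where
  Decomposition : Set
  Decomposition = Σ (Mg k) λ uys → Irrelevant (All (c ≤F_) (proj₂ uys)) × uncurry mg uys ≡ gs

  to : Irrelevant (All (∘¹ c ≤F_) gs) → Decomposition
  to [ p ] = unmg (length c) gs , [ unmg-lb p ] , recompute (≡-dec _≟F_ _ gs) (mg-unmg p)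

  from : Decomposition → Irrelevant (All (∘¹ c ≤F_) gs)
  from ((u , ys) , [ q ] , e) = [ subst (All _) e (mg-lb u ys q) ]

  to∘from : ∀ x → to (from x) ≡ x
  to∘from ((u , ys) , [ q ] , e) = Σ-≡-prop Irrelevant×≡-prop
    (trans (cong (unmg (length c)) (sym e)) (unmg-mg u ys lengths))
    where
    lengths : All (λ y → length y ≡ length c) ys
    lengths = recompute (VecAll.all? (λ y → length y ℕ.≟ length c) ys) (VecAll.map (sym ∘ ≤F⇒length≡) q)

•¹-lb-children : ∀ {c g} → •¹ c ≤F g → c ≤F children (headTree g)
•¹-lb-children (•≤• p ∷ []) = p

•¹-children : ∀ {k c} {gs : Vec Forest k} → All (•¹ c ≤F_) gs → Vec.map (•¹ ∘ children ∘ headTree) gs ≡ gs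
•¹-children []                  = refl
•¹-children ((•≤• _ ∷ []) ∷ ps) = cong (_ ∷_) (•¹-children ps)

•-lb↔map : ∀ {k} c (gs : Vec Forest k) →
           Irrelevant (All (•¹ c ≤F_) gs)
             ↔ Σ (Vec Forest k) λ ys → Irrelevant (All (c ≤F_) ys) × Vec.map •¹ ys ≡ gs
•-lb↔map {k} c gs = mk↔ₛ′ to from to∘from (λ _ → refl)
  where
  Decomposition : Set
  Decomposition = Σ (Vec Forest k) λ ys → Irrelevant (All (c ≤F_) ys) × Vec.map •¹ ys ≡ gs

  to : Irrelevant (All (•¹ c ≤F_) gs) → Decomposition
  to [ p ] = Vec.map (children ∘ headTree) gs , [ VecAllₚ.map⁺ (VecAll.map •¹-lb-children p) ] ,
             recompute (≡-dec _≟F_ _ gs) (trans (sym (map-∘ •¹ _ gs)) (•¹-children p))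

  from : Decomposition → Irrelevant (All (•¹ c ≤F_) gs)
  from (ys , [ q ] , e) = [ subst (All _) e (VecAllₚ.map⁺ (VecAll.map (λ p → •≤• p ∷ []) q)) ]

  to∘from : ∀ x → to (from x) ≡ x
  to∘from (ys , _ , e) = Σ-≡-prop Irrelevant×≡-prop (begin
    Vec.map (children ∘ headTree) gs                  ≡⟨ cong (Vec.map (children ∘ headTree)) e ⟨
    Vec.map (children ∘ headTree) (Vec.map •¹ ys)     ≡⟨ map-∘ (children ∘ headTree) •¹ ys ⟨
    Vec.map (λ y → y) ys                              ≡⟨ map-id ys ⟩
    ys                                                ∎)
    where open ≡-Reasoning

Σ-Forest-≤1 : ∀ {P : Forest → Set} → (∀ {t t' f} → ¬ P (t ∷ t' ∷ f)) →
              Σ Forest P ↔ (P [] ⊎ (Σ Forest (λ c → P (∘¹ c)) ⊎ Σ Forest (λ c → P (•¹ c))))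
Σ-Forest-≤1 {P} ¬P∷∷ = mk↔ₛ′ to from to∘from from∘to
  where
  to : Σ Forest P → P [] ⊎ (Σ Forest (λ c → P (∘¹ c)) ⊎ Σ Forest (λ c → P (•¹ c)))
  to ([]                  , x) = inj₁ x
  to (node white c ∷ []   , x) = inj₂ (inj₁ (c , x))
  to (node black c ∷ []   , x) = inj₂ (inj₂ (c , x))
  to (_ ∷ _ ∷ _           , x) = ⊥-elim (¬P∷∷ x)

  from : P [] ⊎ (Σ Forest (λ c → P (∘¹ c)) ⊎ Σ Forest (λ c → P (•¹ c))) → Σ Forest P
  from (inj₁ x)             = [] , x
  from (inj₂ (inj₁ (c , x))) = ∘¹ c , x
  from (inj₂ (inj₂ (c , x))) = •¹ c , x

  to∘from : ∀ y → to (from y) ≡ y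
  to∘from (inj₁ _)        = refl
  to∘from (inj₂ (inj₁ _)) = refl
  to∘from (inj₂ (inj₂ _)) = refl

  from∘to : ∀ x → from (to x) ≡ x
  from∘to ([]                , _) = refl
  from∘to (node white _ ∷ [] , _) = refl
  from∘to (node black _ ∷ [] , _) = refl
  from∘to (_ ∷ _ ∷ _         , x) = ⊥-elim (¬P∷∷ x)

lowerBounds-ld↔ : ∀ {k} (gs : Vec Forest k) →
  lowerBounds ld gs
    ↔ (εᵏ k gs
       ⊎ (Σ (Vec Colour k) (λ u → Σ (Vec Forest (len u)) λ ys → lowerBounds ld ys × mg u ys ≡ gs)
       ⊎ Σ (Vec Forest k) (λ ys → lowerBounds (P⊙Δ ld) ys × Vec.map •¹ ys ≡ gs)))
lowerBounds-ld↔ {k} gs = ↔-trans (Σ-Forest-≤1 (gr-ld-∷∷ ∘ proj₁)) (root-ε ⊎-↔ (root-∘ ⊎-↔ root-•))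
  where
  root-ε : (gr ld [] × Irrelevant (All ([] ≤F_) gs)) ↔ εᵏ k gs
  root-ε = ↔-trans (×-cong gr-ld-[] ([]-lb↔εᵏ gs)) (×-identityˡ 0ℓ _)

  root-∘ : Σ Forest (λ c → gr ld (∘¹ c) × Irrelevant (All (∘¹ c ≤F_) gs))
             ↔ Σ (Vec Colour k) (λ u → Σ (Vec Forest (len u)) λ ys → lowerBounds ld ys × mg u ys ≡ gs)
  root-∘ = ↔-trans (Σ-cong λ c → ×-cong (gr-ld-∘ c) (∘-lb↔mg c gs)) (↔-trans Σ-×-Σ-interchange Σ-assoc-alt)

  root-• : Σ Forest (λ c → gr ld (•¹ c) × Irrelevant (All (•¹ c ≤F_) gs))
             ↔ Σ (Vec Forest k) (λ ys → lowerBounds (P⊙Δ ld) ys × Vec.map •¹ ys ≡ gs)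
  root-• = ↔-trans (Σ-cong λ c → ×-cong (gr-ld-• c) (•-lb↔map c gs)) Σ-×-Σ-interchange

md-len↔lowerBounds : ∀ S {k} (u : Vec Colour (suc k)) ys → md (len u) (ns S) ys ↔ lowerBounds S ys
md-len↔lowerBounds S (white ∷ _) = md-ns↔lowerBounds S
md-len↔lowerBounds S (black ∷ _) = md-ns↔lowerBounds S

theorem3p4 : ((g : Forest) → ns ld g ↔ md₁ (ns ld) g)
    × ((k : ℕ) → (gs : Vec Forest (suc k)) →
        md (suc k) (ns ld) gs
          ↔ (εᵏ (suc k) gs
             ⊎ (Σ (Vec Colour (suc k)) (λ u → push (mg u) (md (len u) (ns ld)) gs)
             ⊎ bar• (md (suc k) (ns (P⊙Δ ld))) gs)))
theorem3p4 =
  (λ g → ↔-trans (ns↔lowerBounds ld g) (↔-sym (md-ns↔lowerBounds ld (g ∷ [])))) ,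
  λ k gs → ↔-trans (md-ns↔lowerBounds ld gs) (↔-trans (lowerBounds-ld↔ gs)
    (↔-refl ⊎-↔ (Σ-cong (λ u → Σ-cong λ ys → ×-cong (↔-sym (md-len↔lowerBounds ld u ys)) ↔-refl)
                 ⊎-↔ Σ-cong (λ ys → ×-cong (↔-sym (md-ns↔lowerBounds (P⊙Δ ld) ys)) ↔-refl))))
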